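{- Let $\mathcal O\subseteq\mathbb C$ be a subring containing $1$. The map $E:\mathrm{PCF}(\mathcal O)\to\mathrm{SL}_2^\pm(\mathcal O)$ is constant on $\sim$-classes and induces a group homomorphism $\overline E:(\overline{\mathrm{PCF}}(\mathcal O),\star)\to\mathrm{SL}_2^\pm(\mathcal O)$ whose image is $\mathbb E_2^\pm(\mathcal O)$.
   Context: $D(x)=\begin{bmatrix}x&1\\1&0\end{bmatrix}$; $\mathrm{SL}_2^\pm(\mathcal O)$ is the group of matrices in $\mathrm{GL}_2(\mathcal O)$ with determinant $\pm1$; $\mathbb E_2^\pm(\mathcal O)$ is its subgroup generated by $J=\begin{bmatrix}0&1\\1&0\end{bmatrix}$, $U(c)=\begin{bmatrix}1&c\\0&1\end{bmatrix}$, $L(c)=\begin{bmatrix}1&0\\c&1\end{bmatrix}$, $c\in\mathcal O$. A PCF over $\mathcal O$ of type $(N,k)$ is $P=[b_1,\dots,b_N,\overline{a_1,\dots,a_k}]$ ($b_i,a_i\in\mathcal O$, $N\ge0,k\ge1$). $\mathsf{SF}(P)=[b_1,\dots,b_N,a_1,\dots,a_k,0,-b_N,\dots,-b_1,0]$ if $N>0$, $[a_1,\dots,a_k]$ if $N=0$, and $E(P)=D(s_1)\cdots D(s_m)$ where $\mathsf{SF}(P)=[s_1,\dots,s_m]$. On finite sequences, $\sim$ is generated by $u[x,0,y]v\sim u[x+y]v$; $P\sim P'$ means $\mathsf{SF}(P)\sim\mathsf{SF}(P')$. $\overline{\mathrm{PCF}}(\mathcal O)$ is the set of classes with the group operation $\overline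 P\star\overline{P'}=$ class of the purely periodic CF whose repeating block is the concatenation $\mathsf{SF}(P)\mathsf{SF}(P')$. -}

module Defs where

open import Level using (_⊔_)
open import Algebra.Bundles using (CommutativeRing)
open import Data.List using (List; []; _∷_; _++_; reverse; map; [_])
open import Data.List.NonEmpty using (List⁺; _⁺++_; _++⁺_; _⁺++⁺_; toList)
open import Data.List.Relation.Binary.Pointwise using (Pointwise)
open import Data.Product using (_×_)

module Over {c ℓ} (R : CommutativeRing c ℓ) where
  open CommutativeRing R renaming (Carrier to 𝒪)

  record Mat : Set c where
    constructor mat
    field m11 m12 m21 m22 : 𝒪
  open Mat public

  infix 4 _≈M_
  _≈M_ : Mat → Mat → Set ℓ
  A ≈M B = (m11 A ≈ m11 B × m12 A ≈ m12 B) × (m21 A ≈ m21 B × m22 A ≈ m22 B)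

  infixl 7 _·_
  _·_ : Mat → Mat → Mat
  A · B = mat (m11 A * m11 B + m12 A * m21 B) (m11 A * m12 B + m12 A * m22 B)
              (m21 A * m11 B + m22 A * m21 B) (m21 A * m12 B + m22 A * m22 B)

  I : Mat
  I = mat 1# 0# 0# 1#

  det : Mat → 𝒪
  det A = m11 A * m22 A - m12 A * m21 A

  InSL2± : Mat → Set ℓ
  InSL2± A = (det A ≈ 1#) Data.Sum.⊎ (det A ≈ - 1#)
    where import Data.Sum

  D : 𝒪 → Mat
  D x = mat x 1# 1# 0#

  J : Mat
  J = mat 0# 1# 1# 0#

  U : 𝒪 → Mat
  U x = mat 1# x 0# 1#

  L : 𝒪 → Mat
  L x = mat 1# 0# x 1#

  data InE2± : Mat → Set (c ⊔ ℓ) where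
    gen-J : InE2± J
    gen-U : ∀ x → InE2± (U x)
    gen-L : ∀ x → InE2± (L x)
    unit  : InE2± I
    mul   : ∀ {A B} → InE2± A → InE2± B → InE2± (A · B)
    inv   : ∀ {A B} → InE2± A → A · B ≈M I → B · A ≈M I → InE2± B
    resp  : ∀ {A B} → A ≈M B → InE2± A → InE2± B

  -- A periodic continued fraction [b₁,…,b_N, overline(a₁,…,a_k)], k ≥ 1
  record PCF : Set c where
    constructor pcf
    field
      pre : List 𝒪
      per : List⁺ 𝒪
  open PCF public

  SF⁺ : PCF → List⁺ 𝒪
  SF⁺ (pcf [] a)       = a
  SF⁺ (pcf (b ∷ bs) a) =
    (b ∷ bs) ++⁺ (a ⁺++ (0# ∷ (reverse (map -_ (b ∷ bs)) ++ [ 0# ])))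

  SF : PCF → List 𝒪
  SF P = toList (SF⁺ P)

  Dprod : List 𝒪 → Mat
  Dprod []       = I
  Dprod (s ∷ ss) = D s · Dprod ss

  E : PCF → Mat
  E P = Dprod (SF P)

  infix 4 _∼ˢ_
  data _∼ˢ_ : List 𝒪 → List 𝒪 → Set (c ⊔ ℓ) where
    eq    : ∀ {s t} → Pointwise _≈_ s t → s ∼ˢ t
    step  : ∀ u x y v → (u ++ (x ∷ 0# ∷ y ∷ v)) ∼ˢ (u ++ ((x + y) ∷ v))
    sym∼  : ∀ {s t} → s ∼ˢ t → t ∼ˢ s
    trans∼ : ∀ {s t r} → s ∼ˢ t → t ∼ˢ r → s ∼ˢ r

  infix 4 _∼_
  _∼_ : PCF → PCF → Set (c ⊔ ℓ)
  P ∼ P' = SF P ∼ˢ SF P'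

  infixl 7 _⋆_
  _⋆_ : PCF → PCF → PCF
  P ⋆ P' = pcf [] (SF⁺ P ⁺++⁺ SF⁺ P')

{-# OPTIONS --safe #-}
-- Every term of SF(P) contributes a factor D(s) = U(s) J, so E(P) lies in 𝔼₂^±,
-- and det D(s) = -1 gives determinant ±1. The relation ∼ is respected because
-- D(x) J D(y) = U(x) D(y) = D(x + y), and ⋆ is concatenation, which D-products
-- turn into matrix products. Conversely J, U(x), L(x) are D-products of [0],
-- [x, 0], [0, x]; D-products are closed under products, and the inverse of D(x)
-- is J D(-x) J. A word s is then realised by the purely periodic PCF with block
-- 0, 0, s, since J² = I.
module Submission where

open import Defs
open import Algebra.Bundles using (CommutativeRing)
open import Data.Product using (_×_; ∃; _,_)
open import Data.Sum using (inj₁; inj₂)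
open import Data.List using (List; []; _∷_; _++_)
open import Data.List.NonEmpty using () renaming (_∷_ to _∷⁺_)
open import Data.List.Relation.Binary.Pointwise using (Pointwise; []; _∷_)
open import Relation.Binary.Bundles using (Setoid)
import Relation.Binary.Reasoning.Setoid as SetoidReasoning
import Algebra.Properties.AbelianGroup as AbelianGroupProperties
import Algebra.Solver.Ring.NaturalCoefficients.Default as NatSolver

module ContinuedFractionMatrices {c ℓ} (R : CommutativeRing c ℓ) where
  open CommutativeRing R renaming (Carrier to 𝒪)
  open Over R
  open NatSolver commutativeSemiring using (solve; _:=_; _:+_; _:*_; con)
  open AbelianGroupProperties +-abelianGroup using (⁻¹-∙-comm; xyx⁻¹≈y; ⁻¹-anti-homo‿-; ⁻¹-involutive; ε⁻¹≈ε)

  1*a+0*b≈a : ∀ a b → 1# * a + 0# * b ≈ a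
  1*a+0*b≈a = solve 2 (λ a b → con 1 :* a :+ con 0 :* b := a) refl

  0*a+1*b≈b : ∀ a b → 0# * a + 1# * b ≈ b
  0*a+1*b≈b = solve 2 (λ a b → con 0 :* a :+ con 1 :* b := b) refl

  a*1+b*0≈a : ∀ a b → a * 1# + b * 0# ≈ a
  a*1+b*0≈a = solve 2 (λ a b → a :* con 1 :+ b :* con 0 := a) refl

  a*0+b*1≈b : ∀ a b → a * 0# + b * 1# ≈ b
  a*0+b*1≈b = solve 2 (λ a b → a :* con 0 :+ b :* con 1 := b) refl

  ≈M-refl : ∀ {A} → A ≈M A
  ≈M-refl = (refl , refl) , (refl , refl)

  ≈M-sym : ∀ {A B} → A ≈M B → B ≈M A
  ≈M-sym ((e₁₁ , e₁₂) , (e₂₁ , e₂₂)) = (sym e₁₁ , sym e₁₂) , (sym e₂₁ , sym e₂₂)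

  ≈M-trans : ∀ {A B C} → A ≈M B → B ≈M C → A ≈M C
  ≈M-trans ((e₁₁ , e₁₂) , (e₂₁ , e₂₂)) ((f₁₁ , f₁₂) , (f₂₁ , f₂₂)) =
    (trans e₁₁ f₁₁ , trans e₁₂ f₁₂) , (trans e₂₁ f₂₁ , trans e₂₂ f₂₂)

  ≈M-setoid : Setoid c ℓ
  ≈M-setoid = record
    { Carrier = Mat
    ; _≈_ = _≈M_
    ; isEquivalence = record { refl = ≈M-refl ; sym = ≈M-sym ; trans = ≈M-trans }
    }

  module ≈M-Reasoning = SetoidReasoning ≈M-setoid

  ·-cong : ∀ {A A′ B B′} → A ≈M A′ → B ≈M B′ → A · B ≈M A′ · B′
  ·-cong ((a₁ , a₂) , (a₃ , a₄)) ((b₁ , b₂) , (b₃ , b₄)) =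
    (+-cong (*-cong a₁ b₁) (*-cong a₂ b₃) , +-cong (*-cong a₁ b₂) (*-cong a₂ b₄)) ,
    (+-cong (*-cong a₃ b₁) (*-cong a₄ b₃) , +-cong (*-cong a₃ b₂) (*-cong a₄ b₄))

  ·-congˡ : ∀ {A B B′} → B ≈M B′ → A · B ≈M A · B′
  ·-congˡ = ·-cong ≈M-refl

  ·-congʳ : ∀ {A A′ B} → A ≈M A′ → A · B ≈M A′ · B
  ·-congʳ e = ·-cong e ≈M-refl

  ·-assoc : ∀ A B C → (A · B) · C ≈M A · (B · C)
  ·-assoc (mat a b c′ d) (mat e f g h) (mat p q r s) =
    (entry a b p r , entry a b q s) , (entry c′ d p r , entry c′ d q s)
    where
    entry : ∀ a b p q → (a * e + b * g) * p + (a * f + b * h) * q ≈ a * (e * p + f * q) + b * (g * p + h * q)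
    entry a b p q = solve 8 (λ a b e f g h p q →
      (a :* e :+ b :* g) :* p :+ (a :* f :+ b :* h) :* q := a :* (e :* p :+ f :* q) :+ b :* (g :* p :+ h :* q))
      refl a b e f g h p q

  ·-identityˡ : ∀ A → I · A ≈M A
  ·-identityˡ A = (1*a+0*b≈a _ _ , 1*a+0*b≈a _ _) , (0*a+1*b≈b _ _ , 0*a+1*b≈b _ _)

  ·-identityʳ : ∀ A → A · I ≈M A
  ·-identityʳ A = (a*1+b*0≈a _ _ , a*0+b*1≈b _ _) , (a*1+b*0≈a _ _ , a*0+b*1≈b _ _)

  inverse-unique : ∀ {A B C} → B · A ≈M I → A · C ≈M I → B ≈M C
  inverse-unique {A} {B} {C} BA≈I AC≈I = begin
    B            ≈⟨ ·-identityʳ B ⟨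
    B · I        ≈⟨ ·-congˡ AC≈I ⟨
    B · (A · C)  ≈⟨ ·-assoc B A C ⟨
    (B · A) · C  ≈⟨ ·-congʳ BA≈I ⟩
    I · C        ≈⟨ ·-identityˡ C ⟩
    C            ∎
    where open ≈M-Reasoning

  det-cong : ∀ {A B} → A ≈M B → det A ≈ det B
  det-cong ((e₁₁ , e₁₂) , (e₂₁ , e₂₂)) = +-cong (*-cong e₁₁ e₂₂) (-‿cong (*-cong e₁₂ e₂₁))

  det-I : det I ≈ 1#
  det-I = trans (+-cong (*-identityˡ 1#) (trans (-‿cong (zeroˡ 0#)) ε⁻¹≈ε)) (+-identityʳ 1#)

  sub-cancelˡ : ∀ t a b → (t + a) - (t + b) ≈ a - b
  sub-cancelˡ t a b = begin
    (t + a) - (t + b)      ≈⟨ +-congˡ (⁻¹-∙-comm t b) ⟨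
    (t + a) + (- t + - b)  ≈⟨ +-assoc (t + a) (- t) (- b) ⟨
    (t + a + - t) + - b    ≈⟨ +-congʳ (xyx⁻¹≈y t a) ⟩
    a - b                  ∎
    where open SetoidReasoning setoid

  D-cong : ∀ {x y} → x ≈ y → D x ≈M D y
  D-cong x≈y = (x≈y , refl) , (refl , refl)

  D·-rows : ∀ x M → D x · M ≈M mat (x * m11 M + m21 M) (x * m12 M + m22 M) (m11 M) (m12 M)
  D·-rows x M = (+-congˡ (*-identityˡ _) , +-congˡ (*-identityˡ _)) , (1*a+0*b≈a _ _ , 1*a+0*b≈a _ _)

  det-D· : ∀ x M → det (D x · M) ≈ - det M
  det-D· x M@(mat p q r s) = begin
    det (D x · M)                        ≈⟨ det-cong (D·-rows x M) ⟩
    (x * p + r) * q - (x * q + s) * p    ≈⟨ +-cong expand (-‿cong expand′) ⟩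
    (t + q * r) - (t + p * s)            ≈⟨ sub-cancelˡ t (q * r) (p * s) ⟩
    q * r - p * s                        ≈⟨ ⁻¹-anti-homo‿- (p * s) (q * r) ⟨
    - det M                              ∎
    where
    open SetoidReasoning setoid
    t : 𝒪
    t = x * p * q
    expand : (x * p + r) * q ≈ t + q * r
    expand = solve 4 (λ x p q r → (x :* p :+ r) :* q := x :* p :* q :+ q :* r) refl x p q r
    expand′ : (x * q + s) * p ≈ t + p * s
    expand′ = solve 4 (λ x p q s → (x :* q :+ s) :* p := x :* p :* q :+ p :* s) refl x p q s

  D·D0≈U : ∀ x → D x · D 0# ≈M U x
  D·D0≈U x = (a*0+b*1≈b x 1# , a*1+b*0≈a x 1#) , (a*0+b*1≈b 1# 0# , a*1+b*0≈a 1# 0#)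

  U·D0≈D : ∀ x → U x · D 0# ≈M D x
  U·D0≈D x = (a*0+b*1≈b 1# x , a*1+b*0≈a 1# x) , (a*0+b*1≈b 0# 1# , a*1+b*0≈a 0# 1#)

  D0·D≈L : ∀ x → D 0# · D x ≈M L x
  D0·D≈L x = (0*a+1*b≈b x 1# , a*1+b*0≈a 0# 1#) , (1*a+0*b≈a x 1# , 1*a+0*b≈a 1# 0#)

  D0·D0≈I : D 0# · D 0# ≈M I
  D0·D0≈I = D·D0≈U 0#

  U·D≈D+ : ∀ x y → U x · D y ≈M D (x + y)
  U·D≈D+ x y =
    (solve 2 (λ x y → con 1 :* y :+ x :* con 1 := x :+ y) refl x y , a*1+b*0≈a 1# x) ,
    (0*a+1*b≈b y 1# , a*1+b*0≈a 0# 1#)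

  D·D0·D≈D+ : ∀ x y → D x · D 0# · D y ≈M D (x + y)
  D·D0·D≈D+ x y = ≈M-trans (·-congʳ (D·D0≈U x)) (U·D≈D+ x y)

  D-inE2± : ∀ x → InE2± (D x)
  D-inE2± x = resp (U·D0≈D x) (mul (gen-U x) gen-J)

  Dprod-cong : ∀ {s t} → Pointwise _≈_ s t → Dprod s ≈M Dprod t
  Dprod-cong []         = ≈M-refl
  Dprod-cong (x≈y ∷ s≈t) = ·-cong (D-cong x≈y) (Dprod-cong s≈t)

  Dprod-++ : ∀ s t → Dprod (s ++ t) ≈M Dprod s · Dprod t
  Dprod-++ []      t = ≈M-sym (·-identityˡ (Dprod t))
  Dprod-++ (x ∷ s) t = ≈M-trans (·-congˡ (Dprod-++ s t)) (≈M-sym (·-assoc (D x) (Dprod s) (Dprod t)))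

  Dprod-fuse : ∀ x y v → Dprod (x ∷ 0# ∷ y ∷ v) ≈M Dprod (x + y ∷ v)
  Dprod-fuse x y v = begin
    D x · (D 0# · (D y · Dprod v))  ≈⟨ ·-congˡ (·-assoc (D 0#) (D y) (Dprod v)) ⟨
    D x · (D 0# · D y · Dprod v)    ≈⟨ ·-assoc (D x) (D 0# · D y) (Dprod v) ⟨
    D x · (D 0# · D y) · Dprod v    ≈⟨ ·-congʳ (·-assoc (D x) (D 0#) (D y)) ⟨
    D x · D 0# · D y · Dprod v      ≈⟨ ·-congʳ (D·D0·D≈D+ x y) ⟩
    D (x + y) · Dprod v             ∎
    where open ≈M-Reasoning

  Dprod-resp-∼ˢ : ∀ {s t} → s ∼ˢ t → Dprod s ≈M Dprod t
  Dprod-resp-∼ˢ (eq s≈t)       = Dprod-cong s≈t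
  Dprod-resp-∼ˢ (step u x y v) = begin
    Dprod (u ++ x ∷ 0# ∷ y ∷ v)        ≈⟨ Dprod-++ u _ ⟩
    Dprod u · Dprod (x ∷ 0# ∷ y ∷ v)   ≈⟨ ·-congˡ (Dprod-fuse x y v) ⟩
    Dprod u · Dprod (x + y ∷ v)        ≈⟨ Dprod-++ u _ ⟨
    Dprod (u ++ x + y ∷ v)             ∎
    where open ≈M-Reasoning
  Dprod-resp-∼ˢ (sym∼ t∼s)     = ≈M-sym (Dprod-resp-∼ˢ t∼s)
  Dprod-resp-∼ˢ (trans∼ s∼r r∼t) = ≈M-trans (Dprod-resp-∼ˢ s∼r) (Dprod-resp-∼ˢ r∼t)

  Dprod-inSL2± : ∀ s → InSL2± (Dprod s)
  Dprod-inSL2± []      = inj₁ det-I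
  Dprod-inSL2± (x ∷ s) with Dprod-inSL2± s
  ... | inj₁ det≈1  = inj₂ (trans (det-D· x (Dprod s)) (-‿cong det≈1))
  ... | inj₂ det≈-1 = inj₁ (trans (det-D· x (Dprod s)) (trans (-‿cong det≈-1) (⁻¹-involutive 1#)))

  Dprod-inE2± : ∀ s → InE2± (Dprod s)
  Dprod-inE2± []      = unit
  Dprod-inE2± (x ∷ s) = mul (D-inE2± x) (Dprod-inE2± s)

  inverseWord : List 𝒪 → List 𝒪
  inverseWord []      = []
  inverseWord (x ∷ s) = inverseWord s ++ 0# ∷ - x ∷ 0# ∷ []

  D-inverseʳ : ∀ x → D x · Dprod (0# ∷ - x ∷ 0# ∷ []) ≈M I
  D-inverseʳ x = begin
    Dprod (x ∷ 0# ∷ - x ∷ 0# ∷ [])  ≈⟨ Dprod-fuse x (- x) (0# ∷ []) ⟩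
    Dprod (x - x ∷ 0# ∷ [])         ≈⟨ ·-congʳ (D-cong (-‿inverseʳ x)) ⟩
    D 0# · (D 0# · I)               ≈⟨ ·-congˡ (·-identityʳ (D 0#)) ⟩
    D 0# · D 0#                     ≈⟨ D0·D0≈I ⟩
    I                               ∎
    where open ≈M-Reasoning

  Dprod-inverseʳ : ∀ s → Dprod s · Dprod (inverseWord s) ≈M I
  Dprod-inverseʳ []      = ·-identityˡ I
  Dprod-inverseʳ (x ∷ s) = begin
    D x · S · Dprod (inverseWord s ++ t)  ≈⟨ ·-congˡ (Dprod-++ (inverseWord s) t) ⟩
    D x · S · (S⁻¹ · T)                   ≈⟨ ·-assoc (D x · S) S⁻¹ T ⟨
    D x · S · S⁻¹ · T                     ≈⟨ ·-congʳ (·-assoc (D x) S S⁻¹) ⟩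
    D x · (S · S⁻¹) · T                   ≈⟨ ·-congʳ (·-congˡ (Dprod-inverseʳ s)) ⟩
    D x · I · T                           ≈⟨ ·-congʳ (·-identityʳ (D x)) ⟩
    D x · T                               ≈⟨ D-inverseʳ x ⟩
    I                                     ∎
    where
    open ≈M-Reasoning
    t : List 𝒪
    t = 0# ∷ - x ∷ 0# ∷ []
    S S⁻¹ T : Mat
    S = Dprod s
    S⁻¹ = Dprod (inverseWord s)
    T = Dprod t

  InE2±⇒Dprod : ∀ {A} → InE2± A → ∃ λ s → Dprod s ≈M A
  InE2±⇒Dprod gen-J     = 0# ∷ [] , ·-identityʳ J
  InE2±⇒Dprod (gen-U x) = x ∷ 0# ∷ [] , ≈M-trans (·-congˡ (·-identityʳ (D 0#))) (D·D0≈U x)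
  InE2±⇒Dprod (gen-L x) = 0# ∷ x ∷ [] , ≈M-trans (·-congˡ (·-identityʳ (D x))) (D0·D≈L x)
  InE2±⇒Dprod unit      = [] , ≈M-refl
  InE2±⇒Dprod (mul A∈ B∈) with InE2±⇒Dprod A∈ | InE2±⇒Dprod B∈
  ... | s , Ds≈A | t , Dt≈B = s ++ t , ≈M-trans (Dprod-++ s t) (·-cong Ds≈A Dt≈B)
  InE2±⇒Dprod (inv A∈ AB≈I BA≈I) with InE2±⇒Dprod A∈
  ... | s , Ds≈A = inverseWord s ,
    ≈M-sym (inverse-unique (≈M-trans (·-congˡ Ds≈A) BA≈I) (Dprod-inverseʳ s))
  InE2±⇒Dprod (resp A≈B A∈) with InE2±⇒Dprod A∈
  ... | s , Ds≈A = s , ≈M-trans Ds≈A A≈B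

  fromWord : List 𝒪 → PCF
  fromWord s = pcf [] (0# ∷⁺ 0# ∷ s)

  E-fromWord : ∀ s → E (fromWord s) ≈M Dprod s
  E-fromWord s = begin
    D 0# · (D 0# · Dprod s)  ≈⟨ ·-assoc (D 0#) (D 0#) (Dprod s) ⟨
    D 0# · D 0# · Dprod s    ≈⟨ ·-congʳ D0·D0≈I ⟩
    I · Dprod s              ≈⟨ ·-identityˡ (Dprod s) ⟩
    Dprod s                  ∎
    where open ≈M-Reasoning

  E-⋆ : ∀ P P′ → E (P ⋆ P′) ≈M E P · E P′
  E-⋆ P P′ = Dprod-++ (SF P) (SF P′)

proposition5p2 : ∀ {c ℓ} (R : CommutativeRing c ℓ) → let open Over R in
    ((P : PCF) → InSL2± (E P))
    × ((P P' : PCF) → P ∼ P' → E P ≈M E P')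
    × ((P P' : PCF) → E (P ⋆ P') ≈M E P · E P')
    × ((P : PCF) → InE2± (E P))
    × ((A : Mat) → InE2± A → ∃ λ P → E P ≈M A)
proposition5p2 R =
    (λ P → Dprod-inSL2± (SF P))
  , (λ _ _ → Dprod-resp-∼ˢ)
  , E-⋆
  , (λ P → Dprod-inE2± (SF P))
  , λ A A∈ → let (s , Ds≈A) = InE2±⇒Dprod A∈ in
      fromWord s , ≈M-trans (E-fromWord s) Ds≈A
  where
  open Over R using (SF)
  open ContinuedFractionMatrices R
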